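{- Let $G$ be a partial cube with $\Theta$-classes $E_1,\ldots,E_d$. Then $$\overline{WW}(G) = \sum_{i=1}^d n_i^0 n_i^1 + 2\sum_{i=1}^{d-1}\sum_{j=i+1}^d\left(n_{ij}^{00}n_{ij}^{11}+n_{ij}^{01}n_{ij}^{10}\right).$$
   Context: $d(u,v)$ is the shortest-path distance and $\overline{WW}(G)=\sum_{\{u,v\}\subseteq V(G)}d(u,v)^2$ over unordered pairs of distinct vertices. A partial cube is a graph isomorphic to an isometric subgraph of a hypercube. Two edges $u_1v_1$, $u_2v_2$ are in relation $\Theta$ if $d(u_1,u_2)+d(v_1,v_2)\ne d(u_1,v_2)+d(v_1,u_2)$; in a partial cube $\Theta$ is an equivalence relation whose classes are the $\Theta$-classes, and for each $\Theta$-class $E_i$ the graph $G-E_i$ has exactly two connected components, denoted $U_i$ and $U_i'$. Set $n_i^0=|V(U_i)|$, $n_i^1=|V(U_i')|$, and for $i\ne j$: $n_{ij}^{00}=|V(U_i)\cap V(U_j)|$, $n_{ij}^{01}=|V(U_i)\cap V(U_j')|$, $n_{ij}^{10}=|V(U_i')\cap V(U_j)|$, $n_{ij}^{11}=|V(U_i')\cap V(U_j')|$. -}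

module Defs where

open import Data.Nat using (ℕ; zero; suc; _+_; _*_; _≤_; _<ᵇ_)
open import Data.Fin using (Fin; toℕ; zero; suc)
open import Data.Bool using (Bool; true; false; if_then_else_; _xor_; not; _∧_)
open import Data.Product using (Σ; _×_; ∃)
open import Relation.Binary.PropositionalEquality using (_≡_)
open import Relation.Nullary using (¬_)
open import Function.Bundles using (_⇔_)

Σᶠ : (n : ℕ) → (Fin n → ℕ) → ℕ
Σᶠ zero    f = 0
Σᶠ (suc n) f = f zero + Σᶠ n (λ i → f (suc i))

Σ-pairs : (n : ℕ) → (Fin n → Fin n → ℕ) → ℕ
Σ-pairs n g = Σᶠ n (λ i → Σᶠ n (λ j → if toℕ i <ᵇ toℕ j then g i j else 0))

count : (n : ℕ) → (Fin n → Bool) → ℕ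
count n p = Σᶠ n (λ u → if p u then 1 else 0)

record Graph (n : ℕ) : Set where
  field
    adj   : Fin n → Fin n → Bool
    sym   : ∀ u v → adj u v ≡ adj v u
    irrefl : ∀ u → adj u u ≡ false

Edge : ∀ {n} → Graph n → Fin n → Fin n → Set
Edge G u v = Graph.adj G u v ≡ true

data Walk {n : ℕ} (R : Fin n → Fin n → Set) : Fin n → Fin n → ℕ → Set where
  nil  : ∀ {u} → Walk R u u 0
  cons : ∀ {u v w k} → R u v → Walk R v w k → Walk R u w (suc k)

-- dist is the shortest-path distance of G (this also forces G to be connected)
IsShortestPathDist : ∀ {n} → Graph n → (Fin n → Fin n → ℕ) → Set
IsShortestPathDist {n} G dist =
  ∀ u v → Walk (Edge G) u v (dist u v) × (∀ k → Walk (Edge G) u v k → dist u v ≤ k)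

hamming : (m : ℕ) → (Fin m → Bool) → (Fin m → Bool) → ℕ
hamming m x y = count m (λ i → x i xor y i)

IsPartialCube : ∀ {n} → Graph n → (Fin n → Fin n → ℕ) → Set
IsPartialCube {n} G dist =
  Σ ℕ λ m → Σ (Fin n → Fin m → Bool) λ f → ∀ u v → dist u v ≡ hamming m (f u) (f v)

Θ : ∀ {n} → (Fin n → Fin n → ℕ) → Fin n → Fin n → Fin n → Fin n → Set
Θ dist u₁ v₁ u₂ v₂ = ¬ (dist u₁ u₂ + dist v₁ v₂ ≡ dist u₁ v₂ + dist v₁ u₂)

AreΘClasses : ∀ {n} (G : Graph n) (dist : Fin n → Fin n → ℕ) (d : ℕ)
  → (cls : (u v : Fin n) → Edge G u v → Fin d) → Set
AreΘClasses {n} G dist d cls =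
  (∀ u₁ v₁ u₂ v₂ (e₁ : Edge G u₁ v₁) (e₂ : Edge G u₂ v₂) →
     Θ dist u₁ v₁ u₂ v₂ ⇔ (cls u₁ v₁ e₁ ≡ cls u₂ v₂ e₂))
  × (∀ i → Σ (Fin n) λ u → Σ (Fin n) λ v → Σ (Edge G u v) λ e → cls u v e ≡ i)

EdgeMinus : ∀ {n d} (G : Graph n) → ((u v : Fin n) → Edge G u v → Fin d) → Fin d
  → Fin n → Fin n → Set
EdgeMinus G cls i u v = Σ (Edge G u v) λ e → ¬ (cls u v e ≡ i)

ConnectedMinus : ∀ {n d} (G : Graph n) → ((u v : Fin n) → Edge G u v → Fin d) → Fin d
  → Fin n → Fin n → Set
ConnectedMinus G cls i u v = ∃ λ k → Walk (EdgeMinus G cls i) u v k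

-- side i u = false means u ∈ U_i, true means u ∈ U_i'; the two sides are exactly
-- the connected components of G - E_i
AreSides : ∀ {n d} (G : Graph n) → ((u v : Fin n) → Edge G u v → Fin d)
  → (Fin d → Fin n → Bool) → Set
AreSides {n} {d} G cls side =
  ∀ (i : Fin d) (u v : Fin n) → ConnectedMinus G cls i u v ⇔ (side i u ≡ side i v)

WWbar : (n : ℕ) → (Fin n → Fin n → ℕ) → ℕ
WWbar n dist = Σ-pairs n (λ u v → dist u v * dist u v)

module _ {n d : ℕ} (side : Fin d → Fin n → Bool) where
  eqB : Bool → Bool → Bool
  eqB a b = not (a xor b)

  n¹ : Fin d → Bool → ℕ
  n¹ i a = count n (λ u → eqB (side i u) a)

  n² : Fin d → Fin d → Bool → Bool → ℕ
  n² i j a b = count n (λ u → eqB (side i u) a ∧ eqB (side j u) b)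

  WW-formula : ℕ
  WW-formula = Σᶠ d (λ i → n¹ i false * n¹ i true)
    + 2 * Σ-pairs d (λ i j → n² i j false false * n² i j true true
                           + n² i j false true * n² i j true false)

-- An edge ux of class c has u and x
-- on opposite sides of c and on the same side of every other class; if ux starts a geodesic from u
-- to v, the remainder of that geodesic avoids c, so x and v lie on the same side of c. By induction
-- along geodesics, d(u,v) is the number of Θ-classes separating u and v, i.e. the Hamming distance of
-- the side vectors. Then d(u,v)² = Σ_{i,j} [i separates u,v][j separates u,v]; summing over ordered
-- pairs and exchanging sums, the pair (i,j) contributes the number of ordered (u,v) on opposite sides
-- of both classes, 2(n_ij^00 n_ij^11 + n_ij^01 n_ij^10), which for i = j is 2 n_i^0 n_i^1. Halving
-- both double sums gives the formula.
module Submission where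

open import Defs
open import Data.Nat using (ℕ; zero; suc; _+_; _*_; _≤_; _<ᵇ_; s≤s; s≤s⁻¹)
open import Data.Nat.Properties
  using (+-*-semiring; _≟_; ≤-antisym; ≤-trans; +-monoˡ-≤; +-monoʳ-≤; +-cancelʳ-≤; +-cancelˡ-≡;
         +-identityʳ; +-suc; +-comm; +-assoc; +-mono-≤; 0≢1+n; *-comm; *-cancelˡ-≡; n≤0⇒n≡0;
         module ≤-Reasoning)
open import Data.Fin using (Fin; toℕ; zero; suc)
open import Data.Fin.Properties using (suc-injective)
open import Data.Bool using (Bool; true; false; if_then_else_; _xor_; not; _∧_)
open import Data.Bool.Properties using (xor-comm; xor-same; not-involutive; not-distribʳ-xor; ∧-comm; ∧-idem)
open import Data.Product using (_,_; proj₁; proj₂)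
open import Data.Empty using (⊥-elim)
open import Function using (flip; _∘_)
open import Function.Bundles using (Equivalence)
open import Relation.Nullary using (¬_)
open import Relation.Nullary.Decidable using (decidable-stable)
open import Relation.Binary.PropositionalEquality
open import Algebra.Properties.Semiring.Sum +-*-semiring
  using (sum; sum-cong-≗; ∑-distrib-+; ∑-comm; *-distribˡ-sum; *-distribʳ-sum; sum-replicate-zero)
open import Data.Nat.Tactic.RingSolver using (solve-∀)

open Equivalence using (to; from)

Σᶠ≡sum : ∀ n (f : Fin n → ℕ) → Σᶠ n f ≡ sum f
Σᶠ≡sum zero    f = refl
Σᶠ≡sum (suc n) f = cong (f zero +_) (Σᶠ≡sum n (λ i → f (suc i)))

Σᶠ-cong : ∀ n {f g : Fin n → ℕ} → (∀ i → f i ≡ g i) → Σᶠ n f ≡ Σᶠ n g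
Σᶠ-cong n {f} {g} f≗g = trans (Σᶠ≡sum n f) (trans (sum-cong-≗ f≗g) (sym (Σᶠ≡sum n g)))

Σᶠ-zero : ∀ n → Σᶠ n (λ _ → 0) ≡ 0
Σᶠ-zero n = trans (Σᶠ≡sum n _) (sum-replicate-zero n)

Σᶠ-distrib-+ : ∀ n (f g : Fin n → ℕ) → Σᶠ n (λ i → f i + g i) ≡ Σᶠ n f + Σᶠ n g
Σᶠ-distrib-+ n f g =
  trans (Σᶠ≡sum n _) (trans (∑-distrib-+ f g) (sym (cong₂ _+_ (Σᶠ≡sum n f) (Σᶠ≡sum n g))))

Σᶠ-*ˡ : ∀ n c (f : Fin n → ℕ) → c * Σᶠ n f ≡ Σᶠ n (λ i → c * f i)
Σᶠ-*ˡ n c f = trans (cong (c *_) (Σᶠ≡sum n f)) (trans (*-distribˡ-sum c f) (sym (Σᶠ≡sum n _)))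

Σᶠ-*ʳ : ∀ n c (f : Fin n → ℕ) → Σᶠ n f * c ≡ Σᶠ n (λ i → f i * c)
Σᶠ-*ʳ n c f = trans (cong (_* c) (Σᶠ≡sum n f)) (trans (*-distribʳ-sum c f) (sym (Σᶠ≡sum n _)))

Σᶠ-product : ∀ m n (f : Fin m → ℕ) (g : Fin n → ℕ) →
  Σᶠ m f * Σᶠ n g ≡ Σᶠ m (λ i → Σᶠ n (λ j → f i * g j))
Σᶠ-product m n f g = trans (Σᶠ-*ʳ m (Σᶠ n g) f) (Σᶠ-cong m (λ i → Σᶠ-*ˡ n (f i) g))

Σᶠ-comm : ∀ m n (f : Fin m → Fin n → ℕ) →
  Σᶠ m (λ i → Σᶠ n (f i)) ≡ Σᶠ n (λ j → Σᶠ m (λ i → f i j))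
Σᶠ-comm m n f = begin
  Σᶠ m (λ i → Σᶠ n (f i))          ≡⟨ Σᶠ²≡sum² m n f ⟩
  sum (λ i → sum (f i))            ≡⟨ ∑-comm f ⟩
  sum (λ j → sum (λ i → f i j))    ≡⟨ Σᶠ²≡sum² n m (flip f) ⟨
  Σᶠ n (λ j → Σᶠ m (λ i → f i j))  ∎
  where
  open ≡-Reasoning
  Σᶠ²≡sum² : ∀ m n (f : Fin m → Fin n → ℕ) →
    Σᶠ m (λ i → Σᶠ n (f i)) ≡ sum (λ i → sum (f i))
  Σᶠ²≡sum² m n f = trans (Σᶠ-cong m (λ i → Σᶠ≡sum n (f i))) (Σᶠ≡sum m _)

Σᶠ⁴-comm : ∀ m n (f : Fin m → Fin m → Fin n → Fin n → ℕ) →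
  Σᶠ m (λ u → Σᶠ m (λ v → Σᶠ n (λ i → Σᶠ n (f u v i)))) ≡
  Σᶠ n (λ i → Σᶠ n (λ j → Σᶠ m (λ u → Σᶠ m (λ v → f u v i j))))
Σᶠ⁴-comm m n f = begin
  Σᶠ m (λ u → Σᶠ m (λ v → Σᶠ n (λ i → Σᶠ n (f u v i))))
    ≡⟨ Σᶠ-cong m (λ u → Σᶠ-comm m n _) ⟩
  Σᶠ m (λ u → Σᶠ n (λ i → Σᶠ m (λ v → Σᶠ n (f u v i))))
    ≡⟨ Σᶠ-cong m (λ u → Σᶠ-cong n (λ i → Σᶠ-comm m n _)) ⟩
  Σᶠ m (λ u → Σᶠ n (λ i → Σᶠ n (λ j → Σᶠ m (λ v → f u v i j))))
    ≡⟨ Σᶠ-comm m n _ ⟩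
  Σᶠ n (λ i → Σᶠ m (λ u → Σᶠ n (λ j → Σᶠ m (λ v → f u v i j))))
    ≡⟨ Σᶠ-cong n (λ i → Σᶠ-comm m n _) ⟩
  Σᶠ n (λ i → Σᶠ n (λ j → Σᶠ m (λ u → Σᶠ m (λ v → f u v i j)))) ∎
  where open ≡-Reasoning

Σ-pairs-cong : ∀ n {g h : Fin n → Fin n → ℕ} → (∀ i j → g i j ≡ h i j) →
  Σ-pairs n g ≡ Σ-pairs n h
Σ-pairs-cong n g≗h = Σᶠ-cong n (λ i → Σᶠ-cong n (λ j →
  cong (λ x → if toℕ i <ᵇ toℕ j then x else 0) (g≗h i j)))

Σᶠ²-symmetric : ∀ n (g : Fin n → Fin n → ℕ) → (∀ i j → g i j ≡ g j i) →
  Σᶠ n (λ i → Σᶠ n (g i)) ≡ Σᶠ n (λ i → g i i) + 2 * Σ-pairs n g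
Σᶠ²-symmetric zero    g g-sym = refl
Σᶠ²-symmetric (suc n) g g-sym = begin
  g₀₀ + A + Σᶠ n (λ i → g (suc i) zero + Σᶠ n (g′ i))
    ≡⟨ cong (g₀₀ + A +_) (Σᶠ-distrib-+ n _ _) ⟩
  g₀₀ + A + (Σᶠ n (λ i → g (suc i) zero) + Σᶠ n (λ i → Σᶠ n (g′ i)))
    ≡⟨ cong₂ (λ a b → g₀₀ + A + (a + b))
         (Σᶠ-cong n (λ i → g-sym (suc i) zero))
         (Σᶠ²-symmetric n g′ (λ i j → g-sym (suc i) (suc j))) ⟩
  g₀₀ + A + (A + (D + 2 * P))
    ≡⟨ regroup g₀₀ A D P ⟩
  g₀₀ + D + 2 * (A + P) ∎
  where
  open ≡-Reasoning
  g′ : Fin n → Fin n → ℕ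
  g′ i j = g (suc i) (suc j)
  g₀₀ A D P : ℕ
  g₀₀ = g zero zero
  A = Σᶠ n (λ j → g zero (suc j))
  D = Σᶠ n (λ i → g′ i i)
  P = Σ-pairs n g′
  regroup : ∀ a b c d → a + b + (b + (c + 2 * d)) ≡ a + c + 2 * (b + d)
  regroup = solve-∀

𝟙 : Bool → ℕ
𝟙 b = if b then 1 else 0

𝟙-∧ : ∀ a b → 𝟙 a * 𝟙 b ≡ 𝟙 (a ∧ b)
𝟙-∧ false b = refl
𝟙-∧ true  b = +-identityʳ (𝟙 b)

count-cong : ∀ n {p q : Fin n → Bool} → (∀ i → p i ≡ q i) → count n p ≡ count n q
count-cong n p≗q = Σᶠ-cong n (λ i → cong 𝟙 (p≗q i))

count-suc-at : ∀ n (p q : Fin n → Bool) (c : Fin n) → p c ≡ true → q c ≡ false →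
  (∀ i → ¬ i ≡ c → p i ≡ q i) → count n p ≡ suc (count n q)
count-suc-at (suc n) p q zero    pc qc p≗q rewrite pc | qc =
  cong suc (count-cong n (λ i → p≗q (suc i) (λ ())))
count-suc-at (suc n) p q (suc c) pc qc p≗q rewrite p≗q zero (λ ()) =
  trans (cong (𝟙 (q zero) +_) (count-suc-at n (λ i → p (suc i)) (λ i → q (suc i)) c pc qc
                                 (λ i i≢c → p≗q (suc i) (i≢c ∘ suc-injective))))
        (+-suc (𝟙 (q zero)) _)

hamming-refl : ∀ m x → hamming m x x ≡ 0
hamming-refl m x = trans (count-cong m (λ i → xor-same (x i))) (Σᶠ-zero m)

hamming-sym : ∀ m x y → hamming m x y ≡ hamming m y x
hamming-sym m x y = count-cong m (λ i → xor-comm (x i) (y i))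

fibre : ∀ {n} → (Fin n → Bool) → (Fin n → Bool) → Bool → Bool → ℕ
fibre {n} s t a b = count n (λ u → not (s u xor a) ∧ not (t u xor b))

ΣBool² : (Bool → Bool → ℕ) → ℕ
ΣBool² G = G false false + G false true + G true false + G true true

private
  add-to-term₁ : ∀ x a b c d → x + (a + b + c + d) ≡ x + a + b + c + d
  add-to-term₁ = solve-∀
  add-to-term₂ : ∀ x a b c d → x + (a + b + c + d) ≡ a + (x + b) + c + d
  add-to-term₂ = solve-∀
  add-to-term₃ : ∀ x a b c d → x + (a + b + c + d) ≡ a + b + (x + c) + d
  add-to-term₃ = solve-∀
  add-to-term₄ : ∀ x a b c d → x + (a + b + c + d) ≡ a + b + c + (x + d)
  add-to-term₄ = solve-∀

ΣBool²-add-point : ∀ x y (N F : Bool → Bool → ℕ) →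
  F x y + ΣBool² (λ a b → N a b * F a b) ≡
  ΣBool² (λ a b → (𝟙 (not (x xor a) ∧ not (y xor b)) + N a b) * F a b)
ΣBool²-add-point false false N F = add-to-term₁ (F false false) (N false false * F false false) _ _ _
ΣBool²-add-point false true  N F = add-to-term₂ (F false true) (N false false * F false false) _ _ _
ΣBool²-add-point true  false N F = add-to-term₃ (F true false) (N false false * F false false) _ _ _
ΣBool²-add-point true  true  N F = add-to-term₄ (F true true) (N false false * F false false) _ _ _

Σᶠ-by-fibres : ∀ n (s t : Fin n → Bool) (F : Bool → Bool → ℕ) →
  Σᶠ n (λ u → F (s u) (t u)) ≡ ΣBool² (λ a b → fibre s t a b * F a b)
Σᶠ-by-fibres zero    s t F = refl
Σᶠ-by-fibres (suc n) s t F =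
  trans (cong (F (s zero) (t zero) +_) (Σᶠ-by-fibres n (s ∘ suc) (t ∘ suc) F))
        (ΣBool²-add-point (s zero) (t zero) (fibre (s ∘ suc) (t ∘ suc)) F)

xor≡not-xor-not : ∀ a b → a xor b ≡ not (b xor not a)
xor≡not-xor-not a b = begin
  a xor b              ≡⟨ xor-comm a b ⟩
  b xor a              ≡⟨ cong (b xor_) (not-involutive a) ⟨
  b xor not (not a)    ≡⟨ not-distribʳ-xor b (not a) ⟨
  not (b xor not a)    ∎
  where open ≡-Reasoning

Σᶠ²-disagree-on-both : ∀ n (s t : Fin n → Bool) →
  Σᶠ n (λ u → Σᶠ n (λ v → 𝟙 (s u xor s v) * 𝟙 (t u xor t v))) ≡
  2 * (fibre s t false false * fibre s t true true + fibre s t false true * fibre s t true false)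
Σᶠ²-disagree-on-both n s t = begin
  Σᶠ n (λ u → Σᶠ n (λ v → 𝟙 (s u xor s v) * 𝟙 (t u xor t v)))
    ≡⟨ Σᶠ-cong n (λ u → Σᶠ-cong n (λ v → trans (𝟙-∧ (s u xor s v) (t u xor t v))
         (cong₂ (λ a b → 𝟙 (a ∧ b)) (xor≡not-xor-not (s u) (s v)) (xor≡not-xor-not (t u) (t v))))) ⟩
  Σᶠ n (λ u → N (not (s u)) (not (t u)))
    ≡⟨ Σᶠ-by-fibres n s t (λ a b → N (not a) (not b)) ⟩
  ΣBool² (λ a b → N a b * N (not a) (not b))
    ≡⟨ pair-up (N false false) (N false true) (N true false) (N true true) ⟩
  2 * (N false false * N true true + N false true * N true false) ∎
  where
  open ≡-Reasoning
  N : Bool → Bool → ℕ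
  N = fibre s t
  pair-up : ∀ a b c d → a * d + b * c + c * b + d * a ≡ 2 * (a * d + b * c)
  pair-up = solve-∀

fibre-swap : ∀ {n} (s t : Fin n → Bool) a b → fibre t s a b ≡ fibre s t b a
fibre-swap {n} s t a b = count-cong n (λ u → ∧-comm (not (t u xor a)) (not (s u xor b)))

fibre-diagonal : ∀ {n} (s : Fin n → Bool) a → fibre s s a a ≡ count n (λ u → not (s u xor a))
fibre-diagonal {n} s a = count-cong n (λ u → ∧-idem (not (s u xor a)))

fibre-contradictory : ∀ {n} (s : Fin n → Bool) → fibre s s false true ≡ 0
fibre-contradictory {n} s = trans (count-cong n (λ u → contradictory (s u))) (Σᶠ-zero n)
  where
  contradictory : ∀ b → not (b xor false) ∧ not (b xor true) ≡ false
  contradictory false = refl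
  contradictory true  = refl

module _ {n d : ℕ} (f : Fin n → Fin d → Bool) where

  private
    side : Fin d → Fin n → Bool
    side = flip f

    h : Fin n → Fin n → ℕ
    h u v = hamming d (f u) (f v)

    H : Fin d → Fin d → ℕ
    H i j = fibre (side i) (side j) false false * fibre (side i) (side j) true true
          + fibre (side i) (side j) false true * fibre (side i) (side j) true false

    H-sym : ∀ i j → H i j ≡ H j i
    H-sym i j
      rewrite fibre-swap (side i) (side j) false false | fibre-swap (side i) (side j) true true
            | fibre-swap (side i) (side j) false true  | fibre-swap (side i) (side j) true false
      = cong (fibre (side i) (side j) false false * fibre (side i) (side j) true true +_)
             (*-comm (fibre (side i) (side j) false true) (fibre (side i) (side j) true false))

    H-diagonal : ∀ i → H i i ≡ n¹ side i false * n¹ side i true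
    H-diagonal i rewrite fibre-contradictory (side i) =
      trans (+-identityʳ _) (cong₂ _*_ (fibre-diagonal (side i) false) (fibre-diagonal (side i) true))

    Σᶠ²H≡WW-formula : Σᶠ d (λ i → Σᶠ d (H i)) ≡ WW-formula side
    Σᶠ²H≡WW-formula =
      trans (Σᶠ²-symmetric d H H-sym) (cong (_+ 2 * Σ-pairs d H) (Σᶠ-cong d H-diagonal))

    Σᶠ²-hamming² : Σᶠ n (λ u → Σᶠ n (λ v → h u v * h u v)) ≡ 2 * Σᶠ d (λ i → Σᶠ d (H i))
    Σᶠ²-hamming² = begin
      Σᶠ n (λ u → Σᶠ n (λ v → h u v * h u v))
        ≡⟨ Σᶠ-cong n (λ u → Σᶠ-cong n (λ v → Σᶠ-product d d (δ u v) (δ u v))) ⟩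
      Σᶠ n (λ u → Σᶠ n (λ v → Σᶠ d (λ i → Σᶠ d (λ j → δ u v i * δ u v j))))
        ≡⟨ Σᶠ⁴-comm n d (λ u v i j → δ u v i * δ u v j) ⟩
      Σᶠ d (λ i → Σᶠ d (λ j → Σᶠ n (λ u → Σᶠ n (λ v → δ u v i * δ u v j))))
        ≡⟨ Σᶠ-cong d (λ i → Σᶠ-cong d (λ j → Σᶠ²-disagree-on-both n (side i) (side j))) ⟩
      Σᶠ d (λ i → Σᶠ d (λ j → 2 * H i j))
        ≡⟨ Σᶠ-cong d (λ i → Σᶠ-*ˡ d 2 (H i)) ⟨
      Σᶠ d (λ i → 2 * Σᶠ d (H i))
        ≡⟨ Σᶠ-*ˡ d 2 _ ⟨
      2 * Σᶠ d (λ i → Σᶠ d (H i)) ∎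
      where
      open ≡-Reasoning
      δ : Fin n → Fin n → Fin d → ℕ
      δ u v i = 𝟙 (f u i xor f v i)

  Σ-pairs-hamming²≡WW-formula : Σ-pairs n (λ u v → h u v * h u v) ≡ WW-formula side
  Σ-pairs-hamming²≡WW-formula = *-cancelˡ-≡ _ _ 2 (begin
    2 * Σ-pairs n h²
      ≡⟨ cong (_+ 2 * Σ-pairs n h²) diagonal-zero ⟨
    Σᶠ n (λ u → h u u * h u u) + 2 * Σ-pairs n h²
      ≡⟨ Σᶠ²-symmetric n h² (λ u v → cong (λ x → x * x) (hamming-sym d (f u) (f v))) ⟨
    Σᶠ n (λ u → Σᶠ n (h² u))
      ≡⟨ Σᶠ²-hamming² ⟩
    2 * Σᶠ d (λ i → Σᶠ d (H i))
      ≡⟨ cong (2 *_) Σᶠ²H≡WW-formula ⟩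
    2 * WW-formula side ∎)
    where
    open ≡-Reasoning
    h² : Fin n → Fin n → ℕ
    h² u v = h u v * h u v
    diagonal-zero : Σᶠ n (λ u → h² u u) ≡ 0
    diagonal-zero = trans (Σᶠ-cong n (λ u → cong (λ x → x * x) (hamming-refl d (f u)))) (Σᶠ-zero n)

m+o≡n+1+m⇒o≡1+n : ∀ m n o → m + o ≡ n + suc m → o ≡ suc n
m+o≡n+1+m⇒o≡1+n m n o eq = +-cancelˡ-≡ m o (suc n) (begin
  m + o          ≡⟨ eq ⟩
  n + suc m      ≡⟨ +-suc n m ⟩
  suc (n + m)    ≡⟨ cong suc (+-comm n m) ⟩
  suc (m + n)    ≡⟨ +-suc m n ⟨
  m + suc n      ∎)
  where open ≡-Reasoning

≢⇒xor≡true : ∀ a b → ¬ a ≡ b → a xor b ≡ true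
≢⇒xor≡true false false a≢b = ⊥-elim (a≢b refl)
≢⇒xor≡true false true  _   = refl
≢⇒xor≡true true  false _   = refl
≢⇒xor≡true true  true  a≢b = ⊥-elim (a≢b refl)

module _ {n : ℕ} {R : Fin n → Fin n → Set} where

  Walk-++ : ∀ {u v w k l} → Walk R u v k → Walk R v w l → Walk R u w (k + l)
  Walk-++ nil        w′ = w′
  Walk-++ (cons r w) w′ = cons r (Walk-++ w w′)

  Walk₀⇒≡ : ∀ {u v} → Walk R u v 0 → u ≡ v
  Walk₀⇒≡ nil = refl

Edge-sym : ∀ {n} (G : Graph n) {u v} → Edge G u v → Edge G v u
Edge-sym G {u} {v} e = trans (Graph.sym G v u) e

Edge-irrefl : ∀ {n} (G : Graph n) {u} → ¬ Edge G u u
Edge-irrefl G {u} e with trans (sym e) (Graph.irrefl G u)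
... | ()

module ShortestPath {n} (G : Graph n) {dist : Fin n → Fin n → ℕ} (isSP : IsShortestPathDist G dist) where

  geodesic : ∀ u v → Walk (Edge G) u v (dist u v)
  geodesic u v = proj₁ (isSP u v)

  dist-minimal : ∀ {u v k} → Walk (Edge G) u v k → dist u v ≤ k
  dist-minimal {u} {v} {k} = proj₂ (isSP u v) k

  dist-triangle : ∀ u v w → dist u w ≤ dist u v + dist v w
  dist-triangle u v w = dist-minimal (Walk-++ (geodesic u v) (geodesic v w))

  dist-refl : ∀ u → dist u u ≡ 0
  dist-refl u = n≤0⇒n≡0 (dist-minimal nil)

  dist-edge≤1 : ∀ {u v} → Edge G u v → dist u v ≤ 1
  dist-edge≤1 e = dist-minimal (cons e nil)

  dist-edge : ∀ {u v} → Edge G u v → dist u v ≡ 1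
  dist-edge {u} {v} e with dist u v | geodesic u v | dist-edge≤1 e
  ... | zero        | nil | _      = ⊥-elim (Edge-irrefl G e)
  ... | suc zero    | _   | _      = refl
  ... | suc (suc _) | _   | s≤s ()

  dist-across-edge : ∀ {u x} → Edge G u x → ∀ y → dist u y ≤ suc (dist x y)
  dist-across-edge {u} {x} e y = ≤-trans (dist-triangle u x y) (+-monoˡ-≤ (dist x y) (dist-edge≤1 e))

module Θ-classes {n} (G : Graph n) {dist : Fin n → Fin n → ℕ} (isSP : IsShortestPathDist G dist)
  {d} {cls : (u v : Fin n) → Edge G u v → Fin d} (classes : AreΘClasses G dist d cls)
  {side : Fin d → Fin n → Bool} (sides : AreSides G cls side) where

  open ShortestPath G isSP

  other-class⇒balanced : ∀ {u x y z} (e : Edge G u x) (e′ : Edge G y z) → ¬ cls y z e′ ≡ cls u x e →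
    dist u y + dist x z ≡ dist u z + dist x y
  other-class⇒balanced {u} {x} {y} {z} e e′ other =
    decidable-stable (_ ≟ _) (λ unbalanced → other (sym (to (proj₁ classes u x y z e e′) unbalanced)))

  balanced⇒other-class : ∀ {u x y z} (e : Edge G u x) (e′ : Edge G y z) →
    dist u y + dist x z ≡ dist u z + dist x y → ¬ cls y z e′ ≡ cls u x e
  balanced⇒other-class {u} {x} {y} {z} e e′ balanced same =
    from (proj₁ classes u x y z e e′) (sym same) balanced

  edge-keeps-other-sides : ∀ {u x} (e : Edge G u x) i → ¬ cls u x e ≡ i → side i u ≡ side i x
  edge-keeps-other-sides {u} {x} e i other = to (sides i u x) (1 , cons (e , other) nil)

  -- An edge yz not in Θ with ux keeps d(x,·) − d(u,·) constant from y to z. This difference is 1 at u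
  -- and −1 at x, so no walk in G − E_c joins them.
  closer-to-tail-preserved : ∀ {u x} (e : Edge G u x) {y z k} →
    Walk (EdgeMinus G cls (cls u x e)) y z k → dist x y ≡ suc (dist u y) → dist x z ≡ suc (dist u z)
  closer-to-tail-preserved e nil closer = closer
  closer-to-tail-preserved {u} {x} e {y} (cons {v = z} (e′ , other) w) closer =
    closer-to-tail-preserved e w
      (m+o≡n+1+m⇒o≡1+n (dist u y) (dist u z) (dist x z)
        (trans (other-class⇒balanced e e′ other) (cong (dist u z +_) closer)))

  edge-crosses-own-class : ∀ {u x} (e : Edge G u x) → ¬ side (cls u x e) u ≡ side (cls u x e) x
  edge-crosses-own-class {u} {x} e same-side with from (sides (cls u x e) u x) same-side
  ... | _ , w = 0≢1+n (trans (sym (dist-refl x)) (closer-to-tail-preserved e w u-closer-to-tail))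
    where
    u-closer-to-tail : dist x u ≡ suc (dist u u)
    u-closer-to-tail = trans (dist-edge (Edge-sym G e)) (cong suc (sym (dist-refl u)))

  -- When d(u,v) = 1 + d(x,v), every vertex y of a geodesic from x to v has d(u,y) = 1 + d(x,y);
  -- an edge with both ends of this kind is balanced, hence not in Θ with ux. "tight" records that
  -- ux followed by the remaining m steps from y to v is still a geodesic.
  module _ {u x} (e : Edge G u x) {v : Fin n} where

    tight⇒closer-to-head : ∀ {y m} → Walk (Edge G) y v m → dist u v ≡ suc (dist x y + m) →
      dist u y ≡ suc (dist x y)
    tight⇒closer-to-head {y} {m} w tight = ≤-antisym (dist-across-edge e y) (+-cancelʳ-≤ m _ _ (begin
      suc (dist x y) + m     ≡⟨ tight ⟨
      dist u v               ≤⟨ dist-triangle u y v ⟩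
      dist u y + dist y v    ≤⟨ +-monoʳ-≤ (dist u y) (dist-minimal w) ⟩
      dist u y + m           ∎))
      where open ≤-Reasoning

    tight-step : ∀ {y z m} → Edge G y z → Walk (Edge G) z v m →
      dist u v ≡ suc (dist x y + suc m) → dist u v ≡ suc (dist x z + m)
    tight-step {y} {z} {m} e′ w tight = ≤-antisym
      (begin
        dist u v                ≤⟨ dist-triangle u z v ⟩
        dist u z + dist z v     ≤⟨ +-mono-≤ (dist-across-edge e z) (dist-minimal w) ⟩
        suc (dist x z + m)      ∎)
      (begin
        suc (dist x z + m)      ≤⟨ s≤s (+-monoˡ-≤ m xz≤xy+1) ⟩
        suc (dist x y + 1 + m)  ≡⟨ cong suc (+-assoc (dist x y) 1 m) ⟩
        suc (dist x y + suc m)  ≡⟨ tight ⟨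
        dist u v                ∎)
      where
      open ≤-Reasoning
      xz≤xy+1 : dist x z ≤ dist x y + 1
      xz≤xy+1 = ≤-trans (dist-triangle x y z) (+-monoʳ-≤ (dist x y) (dist-edge≤1 e′))

    geodesic-avoids-class : ∀ {y m} → Walk (Edge G) y v m → dist u v ≡ suc (dist x y + m) →
      Walk (EdgeMinus G cls (cls u x e)) y v m
    geodesic-avoids-class nil _ = nil
    geodesic-avoids-class {y} (cons {v = z} e′ w) tight =
      cons (e′ , balanced⇒other-class e e′ balanced) (geodesic-avoids-class w tight′)
      where
      tight′ : dist u v ≡ suc (dist x z + _)
      tight′ = tight-step e′ w tight
      balanced : dist u y + dist x z ≡ dist u z + dist x y
      balanced = begin
        dist u y + dist x z          ≡⟨ cong (_+ dist x z) (tight⇒closer-to-head (cons e′ w) tight) ⟩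
        suc (dist x y + dist x z)    ≡⟨ cong suc (+-comm (dist x y) (dist x z)) ⟩
        suc (dist x z) + dist x y    ≡⟨ cong (_+ dist x y) (tight⇒closer-to-head w tight′) ⟨
        dist u z + dist x y          ∎
        where open ≡-Reasoning

    closer-to-head⇒same-side-as-head : dist u v ≡ suc (dist x v) → side (cls u x e) x ≡ side (cls u x e) v
    closer-to-head⇒same-side-as-head h = to (sides (cls u x e) x v)
      (dist x v , geodesic-avoids-class (geodesic x v)
                    (trans h (cong (λ k → suc (k + dist x v)) (sym (dist-refl x)))))

  hamming-step : ∀ {u x v} (e : Edge G u x) → dist u v ≡ suc (dist x v) →
    hamming d (flip side u) (flip side v) ≡ suc (hamming d (flip side x) (flip side v))
  hamming-step {u} {x} {v} e h =
    count-suc-at d (λ i → side i u xor side i v) (λ i → side i x xor side i v) c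
      (≢⇒xor≡true _ _ (λ u~v → edge-crosses-own-class e (trans u~v (sym x~v))))
      (trans (cong (side c x xor_) (sym x~v)) (xor-same (side c x)))
      (λ i i≢c → cong (_xor side i v) (edge-keeps-other-sides e i (i≢c ∘ sym)))
    where
    c : Fin d
    c = cls u x e
    x~v : side c x ≡ side c v
    x~v = closer-to-head⇒same-side-as-head e h

  dist≡k⇒hamming≡k : ∀ k {u v} → dist u v ≡ k → hamming d (flip side u) (flip side v) ≡ k
  dist≡k⇒hamming≡k zero {u} {v} h with Walk₀⇒≡ (subst (Walk (Edge G) u v) h (geodesic u v))
  ... | refl = hamming-refl d (flip side u)
  dist≡k⇒hamming≡k (suc k) {u} {v} h with subst (Walk (Edge G) u v) h (geodesic u v)
  ... | cons {v = x} e w =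
    trans (hamming-step e (trans h (cong suc (sym xv≡k)))) (cong suc (dist≡k⇒hamming≡k k xv≡k))
    where
    xv≡k : dist x v ≡ k
    xv≡k = ≤-antisym (dist-minimal w)
      (s≤s⁻¹ (subst (_≤ suc (dist x v)) h (dist-minimal (cons e (geodesic x v)))))

  dist≡hamming : ∀ u v → dist u v ≡ hamming d (flip side u) (flip side v)
  dist≡hamming u v = sym (dist≡k⇒hamming≡k (dist u v) refl)

proposition5p1 : (n : ℕ) (G : Graph n) (dist : Fin n → Fin n → ℕ)
    → IsShortestPathDist G dist
    → IsPartialCube G dist
    → (d : ℕ) (cls : (u v : Fin n) → Edge G u v → Fin d)
    → AreΘClasses G dist d cls
    → (side : Fin d → Fin n → Bool)
    → AreSides G cls side
    → WWbar n dist ≡ WW-formula side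
proposition5p1 n G dist isSP _ d cls classes side sides = begin
  WWbar n dist
    ≡⟨ Σ-pairs-cong n (λ u v → cong (λ k → k * k) (dist≡hamming u v)) ⟩
  Σ-pairs n (λ u v → hamming d (flip side u) (flip side v) * hamming d (flip side u) (flip side v))
    ≡⟨ Σ-pairs-hamming²≡WW-formula (flip side) ⟩
  WW-formula side ∎
  where
  open ≡-Reasoning
  open Θ-classes G isSP classes sides
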